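{- For every integer $n\ge1$, let $N(n)$ be the number of tuples $(x_1,\dots,x_n)$ of non-negative integers satisfying $x_1+2x_2+\cdots+nx_n\le n$. Then $$N(n)<2\Big(\frac{e^2}{2}\Big)^{n/2},$$ where $e$ is the base of the natural logarithm. -}

module Defs where

open import Data.Nat using (ℕ; zero; suc; _+_; _*_; _^_; _≤?_)
open import Data.Nat.Properties using (_!≢0)
open import Data.Nat.Base using (_!)
open import Data.Integer using (+_)
open import Data.List using (List; []; _∷_; map; concatMap; upTo; filter; length)
open import Data.Vec using (Vec; []; _∷_)
open import Data.Product using (∃-syntax)
open import Data.Rational using (ℚ; _/_; _<_; 0ℚ) renaming (_+_ to _+ℚ_)

weightFrom : ∀ {k} → ℕ → Vec ℕ k → ℕ
weightFrom w []       = 0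
weightFrom w (x ∷ xs) = w * x + weightFrom (suc w) xs

weight : ∀ {k} → Vec ℕ k → ℕ
weight = weightFrom 1

box : ℕ → (k : ℕ) → List (Vec ℕ k)
box b zero    = [] ∷ []
box b (suc k) = concatMap (λ x → map (x ∷_) (box b k)) (upTo (suc b))

-- N(n) = #{ (x₁,…,xₙ) ∈ ℕⁿ : x₁ + 2x₂ + … + n xₙ ≤ n }.
-- Every such tuple has all xᵢ ≤ n, so it suffices to enumerate {0,…,n}ⁿ.
N : ℕ → ℕ
N n = length (filter (λ v → weight v ≤? n) (box n n))

expPartial : ℕ → ℕ → ℚ
expPartial r zero    = 1ℚ′
  where 1ℚ′ = (+ 1) / 1
expPartial r (suc K) =
  expPartial r K +ℚ ((+ (r ^ suc K)) / (suc K !)) {{suc K !≢0}}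

-- q < e^r  (for rational q, natural r). Since the partial sums increase
-- strictly to e^r, q < e^r holds iff q is below some partial sum.
_<exp_ : ℚ → ℕ → Set
q <exp r = ∃[ K ] (q < expPartial r K)

{-# OPTIONS --safe #-}
-- Write c_w(t) for the number of tuples (x_w, x_{w+1}, …) of naturals with w x_w + (w+1) x_{w+1} + … ≤ t,
-- so that N(n) = c_1(n).  Splitting off the first coordinate gives c_w(t) = Σ_x c_{w+1}(t − x w), so a bound
-- c_{w+1}(s) ≤ K_{w+1} (3/2)^s propagates to c_w(t) ≤ K_w (3/2)^t as soon as K_{w+1} + K_w (2/3)^w ≤ K_w;
-- explicit constants with K_1 = 15.09 give N(n) ≤ 15.09 (3/2)ⁿ.  It then suffices that
-- 15.09² (9/2)ⁿ / 4 ≤ m^m / m! for m = 2n, since m^m / m! is a single term of the series of e^m.  This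
-- holds at n = 14 and propagates from m to m + 2, where m^m / m! grows by a factor of at least 9/2 (the first
-- three terms of the binomial expansion of (1 + 2/m)^{m+1} already show this).  For n < 14 the count and a
-- partial sum of the series are evaluated.
module Submission where

open import Defs
open import Data.Bool using (true; false)
open import Data.Fin using (Fin; toℕ; fromℕ<)
open import Data.Fin.Properties using (all?; toℕ-fromℕ<)
open import Data.Integer using (+_)
import Data.Integer as ℤ
import Data.Integer.Properties as ℤ
open import Data.List using (List; []; _∷_; _++_; map; concat; filter; length; applyUpTo; upTo)
open import Data.List.Properties using (filter-++; length-++; filter-≐; filter-none; map-∘; map-cong; map-upTo)
import Data.List.Relation.Unary.All as All
open import Data.Nat
  using (ℕ; zero; suc; _+_; _*_; _^_; _!; _∸_; _≤_; _<_; _≤?_; _<?_; z≤n; s≤s; s≤s⁻¹; NonZero; >-nonZero)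
open import Data.Nat.ListAction using (sum)
open import Data.Nat.Properties
open import Data.Nat.Tactic.RingSolver using (solve)
open import Algebra.Properties.CommutativeSemigroup *-commutativeSemigroup using (x∙yz≈y∙xz)
open import Data.Product using (_,_)
open import Data.Rational using (_/_)
import Data.Rational as ℚ
import Data.Rational.Properties as ℚ
import Data.Rational.Unnormalised as ℚᵘ
import Data.Rational.Unnormalised.Properties as ℚᵘ
open import Data.Vec using (Vec)
open import Function using (_∘_)
open import Relation.Binary.PropositionalEquality
  using (_≡_; refl; sym; trans; cong; subst; subst₂; module ≡-Reasoning)
open import Relation.Nullary using (yes; no; does)
open import Relation.Nullary.Decidable using (toWitness)

count≤ : {A : Set} → (A → ℕ) → ℕ → List A → ℕ
count≤ μ t xs = length (filter (λ x → μ x ≤? t) xs)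

delay : ℕ → (ℕ → ℕ) → ℕ → ℕ
delay zero    f t       = f t
delay (suc a) f zero    = 0
delay (suc a) f (suc t) = delay a f t

delaySum : ℕ → ℕ → (ℕ → ℕ) → ℕ → ℕ
delaySum w m f t = sum (applyUpTo (λ x → delay (x * w) f t) m)

weightedCount : (w b k : ℕ) → ℕ → ℕ
weightedCount w b zero    t = 1
weightedCount w b (suc k) t = delaySum w (suc b) (weightedCount (suc w) b k) t

module _ {A : Set} where

  count≤-++ : ∀ (μ : A → ℕ) t xs ys → count≤ μ t (xs ++ ys) ≡ count≤ μ t xs + count≤ μ t ys
  count≤-++ μ t xs ys =
    trans (cong length (filter-++ (λ x → μ x ≤? t) xs ys)) (length-++ (filter (λ x → μ x ≤? t) xs))

  count≤-concat : ∀ (μ : A → ℕ) t xss → count≤ μ t (concat xss) ≡ sum (map (count≤ μ t) xss)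
  count≤-concat μ t []         = refl
  count≤-concat μ t (xs ∷ xss) =
    trans (count≤-++ μ t xs (concat xss)) (cong (_+_ (count≤ μ t xs)) (count≤-concat μ t xss))

  count≤-suc : ∀ (μ : A → ℕ) t xs → count≤ (suc ∘ μ) (suc t) xs ≡ count≤ μ t xs
  count≤-suc μ t = cong length ∘ filter-≐ _ _ (s≤s⁻¹ , s≤s)

  count≤-suc-zero : ∀ (μ : A → ℕ) xs → count≤ (suc ∘ μ) zero xs ≡ 0
  count≤-suc-zero μ xs = cong length (filter-none _ (All.universal (λ _ ()) xs))

  count≤-+ : ∀ (μ : A → ℕ) a t xs → count≤ (λ x → a + μ x) t xs ≡ delay a (λ s → count≤ μ s xs) t
  count≤-+ μ zero    t       xs = refl
  count≤-+ μ (suc a) zero    xs = count≤-suc-zero (λ x → a + μ x) xs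
  count≤-+ μ (suc a) (suc t) xs = trans (count≤-suc (λ x → a + μ x) t xs) (count≤-+ μ a t xs)

count≤-map : ∀ {A B : Set} (μ : B → ℕ) (f : A → B) t xs → count≤ μ t (map f xs) ≡ count≤ (μ ∘ f) t xs
count≤-map μ f t []       = refl
count≤-map μ f t (x ∷ xs) with does (μ (f x) ≤? t)
... | true  = cong suc (count≤-map μ f t xs)
... | false = count≤-map μ f t xs

delay-cong : ∀ {f g : ℕ → ℕ} → (∀ s → f s ≡ g s) → ∀ a t → delay a f t ≡ delay a g t
delay-cong f≗g zero    t       = f≗g t
delay-cong f≗g (suc a) zero    = refl
delay-cong f≗g (suc a) (suc t) = delay-cong f≗g a t

weightedCount-correct : ∀ b k w t → count≤ (weightFrom w) t (box b k) ≡ weightedCount w b k t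
weightedCount-correct b zero    w t = refl
weightedCount-correct b (suc k) w t = begin
  count≤ (weightFrom w) t (concat (map withHead (upTo (suc b))))
    ≡⟨ count≤-concat (weightFrom w) t (map withHead (upTo (suc b))) ⟩
  sum (map (count≤ (weightFrom w) t) (map withHead (upTo (suc b))))
    ≡⟨ cong sum (sym (map-∘ (upTo (suc b)))) ⟩
  sum (map (count≤ (weightFrom w) t ∘ withHead) (upTo (suc b)))
    ≡⟨ cong sum (map-cong countWithHead (upTo (suc b))) ⟩
  sum (map (λ x → delay (x * w) (weightedCount (suc w) b k) t) (upTo (suc b)))
    ≡⟨ cong sum (map-upTo _ (suc b)) ⟩
  weightedCount w b (suc k) t ∎
  where
  open ≡-Reasoning
  withHead : ℕ → List (Vec ℕ (suc k))
  withHead x = map (x Vec.∷_) (box b k)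
  countRest : ℕ → ℕ
  countRest s = count≤ (weightFrom (suc w)) s (box b k)
  countWithHead : ∀ x → count≤ (weightFrom w) t (withHead x) ≡ delay (x * w) (weightedCount (suc w) b k) t
  countWithHead x = begin
    count≤ (weightFrom w) t (map (x Vec.∷_) (box b k))
      ≡⟨ count≤-map (weightFrom w) (x Vec.∷_) t (box b k) ⟩
    count≤ (λ v → w * x + weightFrom (suc w) v) t (box b k)
      ≡⟨ count≤-+ (weightFrom (suc w)) (w * x) t (box b k) ⟩
    delay (w * x) countRest t
      ≡⟨ cong (λ a → delay a countRest t) (*-comm w x) ⟩
    delay (x * w) countRest t
      ≡⟨ delay-cong (weightedCount-correct b k (suc w)) (x * w) t ⟩
    delay (x * w) (weightedCount (suc w) b k) t ∎

N≡weightedCount : ∀ n → N n ≡ weightedCount 1 n n n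
N≡weightedCount n = weightedCount-correct n n 1 n

record Bounded (p r E D : ℕ) (g : ℕ → ℕ) : Set where
  field bound : ∀ t → g t * p ^ t * D ≤ E * r ^ t
open Bounded

bounded-cong : ∀ {p r E D g h} → (∀ t → g t ≡ h t) → Bounded p r E D g → Bounded p r E D h
bounded-cong {p} {r} {E} {D} g≗h hg .bound t =
  subst (λ c → c * p ^ t * D ≤ E * r ^ t) (g≗h t) (hg .bound t)

delay-bounded : ∀ {p r E D g} → Bounded p r E D g → ∀ a → Bounded p r (E * p ^ a) (D * r ^ a) (delay a g)
delay-bounded {E = E} {D} hg zero .bound t rewrite *-identityʳ D | *-identityʳ E = hg .bound t
delay-bounded hg (suc a) .bound zero    = z≤n
delay-bounded {p} {r} {E} {D} {g} hg (suc a) .bound (suc t) =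
  shift (delay a g t) (p ^ t) (r ^ a) (p ^ a) (r ^ t) (delay-bounded hg a .bound t)
  where
  shift : ∀ δ pt ra pa rt → δ * pt * (D * ra) ≤ E * pa * rt →
          δ * (p * pt) * (D * (r * ra)) ≤ E * (p * pa) * (r * rt)
  shift δ pt ra pa rt h = begin
    δ * (p * pt) * (D * (r * ra)) ≡⟨ solve (δ ∷ p ∷ pt ∷ D ∷ r ∷ ra ∷ []) ⟩
    (p * r) * (δ * pt * (D * ra)) ≤⟨ *-monoʳ-≤ (p * r) h ⟩
    (p * r) * (E * pa * rt)       ≡⟨ solve (p ∷ r ∷ E ∷ pa ∷ rt ∷ []) ⟩
    E * (p * pa) * (r * rt)       ∎
    where open ≤-Reasoning

bounded-+-delay : ∀ {p r E D E₁ D₁ f g} w → Bounded p r E₁ D₁ f → Bounded p r E D g →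
                  E₁ * D * r ^ w + E * p ^ w * D₁ ≤ E * D₁ * r ^ w → .{{NonZero (D₁ * r ^ w)}} →
                  Bounded p r E D (λ t → f t + delay w g t)
bounded-+-delay {p} {r} {E} {D} {E₁} {D₁} {f} {g} w hf hg K₁+Kqʷ≤K .bound t =
  *-cancelʳ-≤ _ _ (D₁ * r ^ w) (combine (f t) (delay w g t) (p ^ t) (r ^ t) (p ^ w) (r ^ w)
    (hf .bound t) (delay-bounded hg w .bound t) K₁+Kqʷ≤K)
  where
  combine : ∀ x y pt rt pw rw → x * pt * D₁ ≤ E₁ * rt → y * pt * (D * rw) ≤ E * pw * rt →
            E₁ * D * rw + E * pw * D₁ ≤ E * D₁ * rw → (x + y) * pt * D * (D₁ * rw) ≤ E * rt * (D₁ * rw)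
  combine x y pt rt pw rw hx hy hK = begin
    (x + y) * pt * D * (D₁ * rw)                     ≡⟨ solve (x ∷ y ∷ pt ∷ D ∷ D₁ ∷ rw ∷ []) ⟩
    x * pt * D₁ * (D * rw) + y * pt * (D * rw) * D₁  ≤⟨ +-mono-≤ (*-monoˡ-≤ (D * rw) hx) (*-monoˡ-≤ D₁ hy) ⟩
    E₁ * rt * (D * rw) + E * pw * rt * D₁            ≡⟨ solve (E₁ ∷ rt ∷ D ∷ rw ∷ E ∷ pw ∷ D₁ ∷ []) ⟩
    rt * (E₁ * D * rw + E * pw * D₁)                 ≤⟨ *-monoʳ-≤ rt hK ⟩
    rt * (E * D₁ * rw)                               ≡⟨ solve (rt ∷ E ∷ D₁ ∷ rw ∷ []) ⟩
    E * rt * (D₁ * rw)                               ∎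
    where open ≤-Reasoning

sum-applyUpTo-zero : ∀ m → sum (applyUpTo (λ _ → 0) m) ≡ 0
sum-applyUpTo-zero zero    = refl
sum-applyUpTo-zero (suc m) = sum-applyUpTo-zero m

sum-delay-+ : ∀ a (h : ℕ → ℕ) f m t →
  sum (applyUpTo (λ x → delay (a + h x) f t) m) ≡ delay a (λ s → sum (applyUpTo (λ x → delay (h x) f s) m)) t
sum-delay-+ zero    h f m t       = refl
sum-delay-+ (suc a) h f m zero    = sum-applyUpTo-zero m
sum-delay-+ (suc a) h f m (suc t) = sum-delay-+ a h f m t

delaySum-suc : ∀ w m f t → delaySum w (suc m) f t ≡ f t + delay w (delaySum w m f) t
delaySum-suc w m f t = cong (_+_ (f t)) (sum-delay-+ w (_* w) f m t)

delaySum-bounded : ∀ {p r E D E₁ D₁ f} w → Bounded p r E₁ D₁ f →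
                   E₁ * D * r ^ w + E * p ^ w * D₁ ≤ E * D₁ * r ^ w → .{{NonZero (D₁ * r ^ w)}} →
                   ∀ m → Bounded p r E D (delaySum w m f)
delaySum-bounded w hf K₁+Kqʷ≤K zero    .bound t = z≤n
delaySum-bounded {f = f} w hf K₁+Kqʷ≤K (suc m) =
  bounded-cong (λ t → sym (delaySum-suc w m f t))
    (bounded-+-delay w hf (delaySum-bounded w hf K₁+Kqʷ≤K m) K₁+Kqʷ≤K)

-- In terms of K = E / D and K₁ = E₁ / D₁, step says K₁ + K (pʷ / rʷ) ≤ K.
record AdmissibleStep (pʷ rʷ E D E₁ D₁ : ℕ) : Set where
  field
    den≤num    : D ≤ E
    next-den≢0 : NonZero D₁
    step       : E₁ * D * rʷ + E * pʷ * D₁ ≤ E * D₁ * rʷ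

Admissible : (p r : ℕ) (E D : ℕ → ℕ) → Set
Admissible p r E D =
  ∀ w → AdmissibleStep (p ^ suc w) (r ^ suc w) (E (suc w)) (D (suc w)) (E (suc (suc w))) (D (suc (suc w)))

weightedCount-bounded : ∀ {p r} {E D : ℕ → ℕ} .{{_ : NonZero r}} → p ≤ r → Admissible p r E D →
                        ∀ b k w → Bounded p r (E (suc w)) (D (suc w)) (weightedCount (suc w) b k)
weightedCount-bounded {p} {r} {E} {D} p≤r adm b zero w .bound t = begin
  1 * p ^ t * D (suc w) ≡⟨ cong (_* D (suc w)) (*-identityˡ (p ^ t)) ⟩
  p ^ t * D (suc w)     ≤⟨ *-mono-≤ (^-monoˡ-≤ t p≤r) (AdmissibleStep.den≤num (adm w)) ⟩
  r ^ t * E (suc w)     ≡⟨ *-comm (r ^ t) (E (suc w)) ⟩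
  E (suc w) * r ^ t     ∎
  where open ≤-Reasoning
weightedCount-bounded {p} {r} {E} {D} p≤r adm b (suc k) w =
  delaySum-bounded (suc w) (weightedCount-bounded {E = E} {D} p≤r adm b k (suc w)) step
    {{m*n≢0 (D (suc (suc w))) (r ^ suc w) {{next-den≢0}} {{m^n≢0 r (suc w)}}}} (suc b)
  where open AdmissibleStep (adm w)

-- tailNum w / tailDen w ≥ ∏_{j ≥ w} (1 − (2/3)^j)⁻¹: for w ≥ 6 it is (1 − 3 (2/3)^w)⁻¹,
-- below that a rounded-up decimal.
tailNum : ℕ → ℕ
tailNum 1 = 1509
tailNum 2 = 503
tailNum 3 = 279
tailNum 4 = 196
tailNum 5 = 157
tailNum w = 3 ^ w

tailDen : ℕ → ℕ
tailDen 1 = 100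
tailDen 2 = 100
tailDen 3 = 100
tailDen 4 = 100
tailDen 5 = 100
tailDen w = 3 ^ w ∸ 3 * 2 ^ w

3*2^[3+n]≤3^[3+n] : ∀ n → 3 * 2 ^ (3 + n) ≤ 3 ^ (3 + n)
3*2^[3+n]≤3^[3+n] zero    = ≤ᵇ⇒≤ 24 27 _
3*2^[3+n]≤3^[3+n] (suc n) = begin
  3 * (2 * 2 ^ (3 + n)) ≡⟨ x∙yz≈y∙xz 3 2 (2 ^ (3 + n)) ⟩
  2 * (3 * 2 ^ (3 + n)) ≤⟨ *-mono-≤ (≤ᵇ⇒≤ 2 3 _) (3*2^[3+n]≤3^[3+n] n) ⟩
  3 * 3 ^ (3 + n)       ∎
  where open ≤-Reasoning

admissibleStep-tail : ∀ a b → 0 < b → 3 * b ≤ a → AdmissibleStep b a a (a ∸ 3 * b) (3 * a) (3 * a ∸ 3 * (2 * b))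
admissibleStep-tail a b b>0 3b≤a with a ∸ 3 * b | m∸n+n≡m 3b≤a
... | d | refl = subst (AdmissibleStep b (d + 3 * b) (d + 3 * b) d (3 * (d + 3 * b))) (sym next-den) (record
  { den≤num    = m≤m+n d (3 * b)
  ; next-den≢0 = >-nonZero (≤-trans b>0 (≤-trans (m≤m+n b (2 * b)) (m≤n+m (3 * b) (3 * d))))
  ; step       = ≤-trans (m≤m+n _ (6 * (d + 3 * b) * b * b)) (≤-reflexive slack)
  })
  where
  three-a : 3 * (d + 3 * b) ≡ 3 * d + 3 * b + 3 * (2 * b)
  three-a = solve (d ∷ b ∷ [])
  next-den : 3 * (d + 3 * b) ∸ 3 * (2 * b) ≡ 3 * d + 3 * b
  next-den = trans (cong (_∸ 3 * (2 * b)) three-a) (m+n∸n≡m (3 * d + 3 * b) (3 * (2 * b)))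
  slack : 3 * (d + 3 * b) * d * (d + 3 * b) + (d + 3 * b) * b * (3 * d + 3 * b) + 6 * (d + 3 * b) * b * b
        ≡ (d + 3 * b) * (3 * d + 3 * b) * (d + 3 * b)
  slack = solve (d ∷ b ∷ [])

tail-admissible : Admissible 2 3 tailNum tailDen
tail-admissible 0 = record { den≤num = ≤ᵇ⇒≤ _ _ _ ; next-den≢0 = _ ; step = ≤ᵇ⇒≤ _ _ _ }
tail-admissible 1 = record { den≤num = ≤ᵇ⇒≤ _ _ _ ; next-den≢0 = _ ; step = ≤ᵇ⇒≤ _ _ _ }
tail-admissible 2 = record { den≤num = ≤ᵇ⇒≤ _ _ _ ; next-den≢0 = _ ; step = ≤ᵇ⇒≤ _ _ _ }
tail-admissible 3 = record { den≤num = ≤ᵇ⇒≤ _ _ _ ; next-den≢0 = _ ; step = ≤ᵇ⇒≤ _ _ _ }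
tail-admissible 4 = record { den≤num = ≤ᵇ⇒≤ _ _ _ ; next-den≢0 = _ ; step = ≤ᵇ⇒≤ _ _ _ }
tail-admissible (suc (suc (suc (suc (suc n))))) =
  admissibleStep-tail (3 ^ (6 + n)) (2 ^ (6 + n)) (m^n>0 2 (6 + n)) (3*2^[3+n]≤3^[3+n] (3 + n))

N-bound : ∀ n → N n * 2 ^ n * 100 ≤ 1509 * 3 ^ n
N-bound n rewrite N≡weightedCount n =
  weightedCount-bounded {E = tailNum} {tailDen} (≤ᵇ⇒≤ 2 3 _) tail-admissible n n 0 .bound n

binomial-three-terms : ∀ a b j →
  a ^ suc j * (2 * a * a + 2 * suc j * a * b + suc j * j * b * b) ≤ 2 * (a + b) ^ suc j * (a * a)
binomial-three-terms a b zero    = ≤-reflexive base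
  where
  base : a * 1 * (2 * a * a + 2 * 1 * a * b + 1 * 0 * b * b) ≡ 2 * ((a + b) * 1) * (a * a)
  base = solve (a ∷ b ∷ [])
binomial-three-terms a b (suc j) = begin
  a * A * (2 * a * a + 2 * (2 + j) * a * b + (2 + j) * (1 + j) * b * b)
    ≤⟨ m≤m+n _ (A * (1 + j) * j * (b * b * b)) ⟩
  a * A * (2 * a * a + 2 * (2 + j) * a * b + (2 + j) * (1 + j) * b * b) + A * (1 + j) * j * (b * b * b)
    ≡⟨ expand A ⟩
  (a + b) * (A * (2 * a * a + 2 * (1 + j) * a * b + (1 + j) * j * b * b))
    ≤⟨ *-monoʳ-≤ (a + b) (binomial-three-terms a b j) ⟩
  (a + b) * (2 * (a + b) ^ suc j * (a * a))
    ≡⟨ regroup ((a + b) ^ suc j) ⟩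
  2 * ((a + b) * (a + b) ^ suc j) * (a * a) ∎
  where
  open ≤-Reasoning
  A = a ^ suc j
  expand : ∀ P → a * P * (2 * a * a + 2 * (2 + j) * a * b + (2 + j) * (1 + j) * b * b) + P * (1 + j) * j * (b * b * b)
                ≡ (a + b) * (P * (2 * a * a + 2 * (1 + j) * a * b + (1 + j) * j * b * b))
  expand P = solve (a ∷ b ∷ j ∷ P ∷ [])
  regroup : ∀ P → (a + b) * (2 * P * (a * a)) ≡ 2 * ((a + b) * P) * (a * a)
  regroup P = solve (a ∷ b ∷ P ∷ [])

pow-ratio : ∀ m → 1 ≤ m → 9 * (1 + m) * m ^ m ≤ 2 * (2 + m) ^ (1 + m)
pow-ratio m@(suc k) _ = begin
  9 * (1 + m) * M       ≤⟨ *-monoˡ-≤ M (≤-trans (m≤m+n (9 * (1 + m)) k) (≤-reflexive (coefficients k))) ⟩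
  (10 * m + 8) * M      ≤⟨ *-cancelʳ-≤ _ _ (m * m) (≤-trans (≤-reflexive (expand M)) three-terms) ⟩
  2 * (2 + m) ^ (1 + m) ∎
  where
  open ≤-Reasoning
  M = m ^ m
  coefficients : ∀ k → 9 * (2 + k) + k ≡ 10 * (1 + k) + 8
  coefficients k = solve (k ∷ [])
  three-terms : m ^ suc m * (2 * m * m + 2 * suc m * m * 2 + suc m * m * 2 * 2) ≤ 2 * (2 + m) ^ suc m * (m * m)
  three-terms = subst (λ x → m ^ suc m * (2 * m * m + 2 * suc m * m * 2 + suc m * m * 2 * 2) ≤ 2 * x ^ suc m * (m * m))
                      (+-comm m 2) (binomial-three-terms m 2 m)
  expand : ∀ M → (10 * m + 8) * M * (m * m) ≡ m * M * (2 * m * m + 2 * (1 + m) * m * 2 + (1 + m) * m * 2 * 2)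
  expand M = solve (k ∷ M ∷ [])

pow-factorial-growth : ∀ m → 1 ≤ m → 9 * m ^ m * (2 + m) ! ≤ 2 * (2 + m) ^ (2 + m) * m !
pow-factorial-growth m 1≤m = begin
  9 * m ^ m * ((2 + m) * ((1 + m) * m !))   ≡⟨ regroup (m ^ m) (m !) ⟩
  (2 + m) * (9 * (1 + m) * m ^ m) * m !     ≤⟨ *-monoˡ-≤ (m !) (*-monoʳ-≤ (2 + m) (pow-ratio m 1≤m)) ⟩
  (2 + m) * (2 * (2 + m) ^ (1 + m)) * m !   ≡⟨ regroup′ ((2 + m) ^ (1 + m)) (m !) ⟩
  2 * ((2 + m) * (2 + m) ^ (1 + m)) * m !   ∎
  where
  open ≤-Reasoning
  regroup : ∀ M F → 9 * M * ((2 + m) * ((1 + m) * F)) ≡ (2 + m) * (9 * (1 + m) * M) * F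
  regroup M F = solve (m ∷ M ∷ F ∷ [])
  regroup′ : ∀ P F → (2 + m) * (2 * P) * F ≡ 2 * ((2 + m) * P) * F
  regroup′ P F = solve (m ∷ P ∷ F ∷ [])

pow-factorial-ratio-step : ∀ {A B X Y} m → 1 ≤ m → A * X * m ! ≤ B * Y * m ^ m →
                           A * (9 * X) * (2 + m) ! ≤ B * (2 * Y) * (2 + m) ^ (2 + m)
pow-factorial-ratio-step {A} {B} {X} {Y} m 1≤m hyp = *-cancelʳ-≤ _ _ (m ^ m) {{m^n≢0 m m {{>-nonZero 1≤m}}}} (begin
  A * (9 * X) * (2 + m) ! * m ^ m         ≡⟨ regroup (m ^ m) ((2 + m) !) ⟩
  A * X * (9 * m ^ m * (2 + m) !)         ≤⟨ *-monoʳ-≤ (A * X) (pow-factorial-growth m 1≤m) ⟩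
  A * X * (2 * (2 + m) ^ (2 + m) * m !)   ≡⟨ regroup′ ((2 + m) ^ (2 + m)) (m !) ⟩
  2 * (2 + m) ^ (2 + m) * (A * X * m !)   ≤⟨ *-monoʳ-≤ (2 * (2 + m) ^ (2 + m)) hyp ⟩
  2 * (2 + m) ^ (2 + m) * (B * Y * m ^ m) ≡⟨ regroup″ ((2 + m) ^ (2 + m)) (m ^ m) ⟩
  B * (2 * Y) * (2 + m) ^ (2 + m) * m ^ m ∎)
  where
  open ≤-Reasoning
  regroup : ∀ M F → A * (9 * X) * F * M ≡ A * X * (9 * M * F)
  regroup M F = solve (A ∷ X ∷ M ∷ F ∷ [])
  regroup′ : ∀ P F → A * X * (2 * P * F) ≡ 2 * P * (A * X * F)
  regroup′ P F = solve (A ∷ X ∷ P ∷ F ∷ [])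
  regroup″ : ∀ P M → 2 * P * (B * Y * M) ≡ B * (2 * Y) * P * M
  regroup″ P M = solve (B ∷ Y ∷ P ∷ M ∷ [])

pow-factorial-bound-step : ∀ {A B} n → 1 ≤ n → A * 9 ^ n * (2 * n) ! ≤ B * 2 ^ n * (2 * n) ^ (2 * n) →
                           A * 9 ^ suc n * (2 * suc n) ! ≤ B * 2 ^ suc n * (2 * suc n) ^ (2 * suc n)
pow-factorial-bound-step {A} {B} n 1≤n hyp =
  subst (λ m → A * 9 ^ suc n * m ! ≤ B * 2 ^ suc n * m ^ m) (sym (*-suc 2 n))
    (pow-factorial-ratio-step {A} {B} {9 ^ n} {2 ^ n} (2 * n) (≤-trans 1≤n (m≤n*m n 2)) hyp)

pow-factorial-bound : ∀ i → let n = i + 14 in 1509 * 1509 * 9 ^ n * (2 * n) ! ≤ 40000 * 2 ^ n * (2 * n) ^ (2 * n)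
pow-factorial-bound zero    = ≤ᵇ⇒≤ _ _ _
pow-factorial-bound (suc i) =
  pow-factorial-bound-step {1509 * 1509} {40000} (i + 14) (≤-trans (s≤s z≤n) (m≤n+m 14 i)) (pow-factorial-bound i)

toℚᵘ-/ : ∀ i b .{{_ : NonZero b}} → ℚ.toℚᵘ (i / b) ℚᵘ.≃ (i ℚᵘ./ b)
toℚᵘ-/ i (suc b) = ℚ.toℚᵘ-fromℚᵘ (ℚᵘ.mkℚᵘ i b)

/-mono-≤ : ∀ a b c d .{{_ : NonZero b}} .{{_ : NonZero d}} → a * d ≤ c * b → (+ a) / b ℚ.≤ (+ c) / d
/-mono-≤ a b@(suc _) c d@(suc _) ad≤cb = ℚ.toℚᵘ-cancel-≤
  (ℚᵘ.≤-respʳ-≃ (ℚᵘ.≃-sym (toℚᵘ-/ (+ c) d)) (ℚᵘ.≤-respˡ-≃ (ℚᵘ.≃-sym (toℚᵘ-/ (+ a) b))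
    (ℚᵘ.*≤* (subst₂ ℤ._≤_ (ℤ.pos-* a d) (ℤ.pos-* c b) (ℤ.+≤+ ad≤cb)))))

expPartial-pos : ∀ r K → ℚ.0ℚ ℚ.< expPartial r K
expPartial-pos r zero    = toWitness {a? = ℚ.0ℚ ℚ.<? expPartial r zero} _
expPartial-pos r (suc K) = subst (ℚ._< expPartial r (suc K)) (ℚ.+-identityʳ ℚ.0ℚ)
  (ℚ.+-mono-<-≤ (expPartial-pos r K) (ℚ.nonNegative⁻¹ _ {{ℚ.normalize-nonNeg (r ^ suc K) (suc K !) {{suc K !≢0}}}}))

term<expPartial : ∀ r K → ((+ (r ^ suc K)) / (suc K !)) {{suc K !≢0}} ℚ.< expPartial r (suc K)
term<expPartial r K = subst (ℚ._< expPartial r (suc K)) (ℚ.+-identityˡ _)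
  (ℚ.+-mono-<-≤ (expPartial-pos r K) ℚ.≤-refl)

<exp-from-term : ∀ X m → X * m ! ≤ m ^ m * 4 → 1 ≤ m → ((+ X) / 4) <exp m
<exp-from-term X (suc K) Xm!≤mᵐ4 _ =
  suc K , ℚ.≤-<-trans (/-mono-≤ X 4 (suc K ^ suc K) (suc K !) {{_}} {{suc K !≢0}} Xm!≤mᵐ4) (term<expPartial (suc K) K)

^-square : ∀ m n → m ^ n * m ^ n ≡ (m * m) ^ n
^-square m zero    = refl
^-square m (suc n) = trans (regroup (m ^ n)) (cong (m * m *_) (^-square m n))
  where
  regroup : ∀ P → m * P * (m * P) ≡ m * m * (P * P)
  regroup P = solve (m ∷ P ∷ [])

square-bound : ∀ c d x P T S F M → T * T ≡ S → x * P * d ≤ c * T → c * c * S * F ≤ 4 * (d * d) * P * M →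
               .{{NonZero (P * (d * d))}} → x * x * P * F ≤ M * 4
square-bound c d x P T S F M T²≡S xPd≤cT SF≤PM = *-cancelʳ-≤ _ _ (P * (d * d)) (begin
  x * x * P * F * (P * (d * d))  ≡⟨ solve (d ∷ x ∷ P ∷ F ∷ []) ⟩
  (x * P * d) * (x * P * d) * F  ≤⟨ *-monoˡ-≤ F (*-mono-≤ xPd≤cT xPd≤cT) ⟩
  (c * T) * (c * T) * F          ≡⟨ solve (c ∷ T ∷ F ∷ []) ⟩
  c * c * (T * T) * F            ≡⟨ cong (λ s → c * c * s * F) T²≡S ⟩
  c * c * S * F                  ≤⟨ SF≤PM ⟩
  4 * (d * d) * P * M            ≡⟨ solve (d ∷ P ∷ M ∷ []) ⟩
  M * 4 * (P * (d * d))          ∎)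
  where open ≤-Reasoning

ExpBound : ℕ → Set
ExpBound n = ((+ (N n * N n * 2 ^ n)) / 4) <exp (2 * n)

large-case : ∀ i → ExpBound (i + 14)
large-case i =
  <exp-from-term (N n * N n * 2 ^ n) (2 * n)
    (square-bound 1509 100 (N n) (2 ^ n) (3 ^ n) (9 ^ n) ((2 * n) !) ((2 * n) ^ (2 * n))
      (^-square 3 n) (N-bound n) (pow-factorial-bound i) {{m*n≢0 (2 ^ n) 10000 {{m^n≢0 2 n}}}})
    (≤-trans (≤-trans (s≤s z≤n) (m≤n+m 14 i)) (m≤n*m n 2))
  where n = i + 14

BelowPartialSum : ℕ → ℕ → Set
BelowPartialSum c n = ((+ (c * c * 2 ^ n)) / 4) ℚ.< expPartial (2 * n) (2 * n)

small-cases : ∀ (i : Fin 13) → let n = suc (toℕ i) in BelowPartialSum (weightedCount 1 n n n) n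
small-cases = toWitness {a? = all? (λ i → _ ℚ.<? _)} _

small-case : ∀ n → 1 ≤ n → n < 14 → ExpBound n
small-case (suc m) _ n<14 = 2 * suc m ,
  subst (λ c → BelowPartialSum c (suc m)) (sym (N≡weightedCount (suc m)))
    (subst (λ k → BelowPartialSum (weightedCount 1 (suc k) (suc k) (suc k)) (suc k))
      (toℕ-fromℕ< (s≤s⁻¹ n<14)) (small-cases (fromℕ< (s≤s⁻¹ n<14))))

mainTheorem14 : (n : ℕ) → 1 ≤ n → ((+ (N n * N n * 2 ^ n)) / 4) <exp (2 * n)
mainTheorem14 n 1≤n with n <? 14
... | yes n<14 = small-case n 1≤n n<14
... | no  n≮14 = subst ExpBound (m∸n+n≡m (≮⇒≥ n≮14)) (large-case (n ∸ 14))
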